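{- Let $G$ be a formula, $\mathcal D$ an $\mathbf{FRJ}(G)$-derivation of $G$, $\mathrm{Mod}(\mathcal D)$ the model extracted from $\mathcal D$ and $\phi$ the map associated with $\mathcal D$. For every sequent $\sigma$ occurring in $\mathcal D$: (i) if $\sigma=\Gamma\Rightarrow C$, then $\phi(\sigma)$ forces every formula of $\Gamma$ and $\phi(\sigma)$ does not force $C$; (ii) if $\sigma=\Sigma;\Theta\rightarrow C$, then for every p-sequent $\sigma_p$ of $\mathcal D$ such that $\sigma\mapsto\sigma_p$ and $\sigma_p$ forces every formula in $\Sigma\cap\mathrm{Sf}^-(C)$, $\sigma_p$ does not force $C$.
   Context: Formulas are built from a countably infinite set $\mathcal{V}$ of propositional variables and $\bot$ using $\land,\lor,\supset$. Let $\mathcal{V}_\bot=\mathcal{V}\cup\{\bot\}$, $\mathcal{L}^{\supset}$ the set of formulas with main connective $\supset$; $\mathrm{Sf}(C)$ is the set of subformulas of $C$ and $\mathrm{Sf}^-(C)=\mathrm{Sf}(C)\setminus\{C\}$. For a formula $G$, $\mathrm{Sl}(G)$ and $\mathrm{Sr}(G)$ are the smallest subsets of the subformulas of $G$ with: $G\in\mathrm{Sr}(G)$; $A\land B$ or $A\lor B$ in $\mathrm{Sl}(G)$ (resp. $\mathrm{Sr}(G)$) implies $A,B$ in $\mathrm{Sl}(G)$ (resp. $\mathrm{Sr}(G)$); $A\supset B\in\mathrm{Sl}(G)$ implies $B\in\mathrm{Sl}(G)$, $A\in\mathrm{Sr}(G)$; $A\supset B\in\mathrm{Sr}(G)$ implies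 $B\in\mathrm{Sr}(G)$, $A\in\mathrm{Sl}(G)$. $\mathrm{Cl}(\Gamma)$ is the smallest set containing $\Gamma$ such that if $X,Y\in\mathrm{Cl}(\Gamma)$ and $A$ is any formula then $X\land Y,A\lor X,X\lor A,A\supset X\in\mathrm{Cl}(\Gamma)$. $\mathbf{FRJ}(G)$: let $\bar\Gamma^{At}=\mathrm{Sl}(G)\cap\mathcal V$, $\bar\Gamma^{\supset}=\mathrm{Sl}(G)\cap\mathcal L^{\supset}$, $\bar\Gamma=\bar\Gamma^{At}\cup\bar\Gamma^{\supset}$. Sequents: regular $\Gamma\Rightarrow C$ ($\Gamma\subseteq\bar\Gamma$, $C\in\mathrm{Sr}(G)$), irregular $\Sigma;\Theta\rightarrow C$ ($\Sigma\cup\Theta\subseteq\bar\Gamma$, $C\in\mathrm{Sr}(G)$); $\mathrm{Lhs}$ is $\Gamma$, resp. $\Sigma\cup\Theta$; conclusions always have right formula in $\mathrm{Sr}(G)$. Rules ($F\in\mathcal V_\bot$, $k\in\{1,2\}$): axioms $\bar\Gamma^{At}\setminus\{F\}\Rightarrow F$ and $\emptyset;(\bar\Gamma^{At}\setminus\{F\})\cup\bar\Gamma^{\supset}\rightarrow F$; ($\land$) $\Gamma\Rightarrow A_k/\Gamma\Rightarrow A_1\land A_2$ and $\Sigma;\Theta\rightarrow A_k/\Sigma;\Theta\rightarrow A_1\land A_2$; ($\lor$) $\Sigma_1;\Theta_1\rightarrow C_1$, $\Sigma_2;\Theta_2\rightarrow C_2 / \Sigma_1\cup\Sigma_2;\Theta_1\cap\Theta_2\rightarrow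 C_1\lor C_2$ if $\Sigma_1\subseteq\Sigma_2\cup\Theta_2$, $\Sigma_2\subseteq\Sigma_1\cup\Theta_1$; ($\supset_\in$) $\Gamma\Rightarrow B/\Gamma\Rightarrow A\supset B$ if $A\in\mathrm{Cl}(\Gamma)$, and $\Sigma;\Theta\cup\Lambda\rightarrow B/\Sigma\cup\Lambda;\Theta\rightarrow A\supset B$ if $\Theta\cap\Lambda=\emptyset$, $A\in\mathrm{Cl}(\Sigma\cup\Lambda)$ and no $\Lambda'\subsetneq\Lambda$ has $A\in\mathrm{Cl}(\Sigma\cup\Lambda')$; ($\supset_{\notin}$) $\Gamma\Rightarrow B/\emptyset;\Theta\rightarrow A\supset B$ if $\Theta\subseteq\mathrm{Cl}(\Gamma)\cap\bar\Gamma$, $A\in\mathrm{Cl}(\Gamma)\setminus\mathrm{Cl}(\Theta)$ and every $\Theta'$ with $\Theta\subsetneq\Theta'\subseteq\mathrm{Cl}(\Gamma)\cap\bar\Gamma$ has $A\in\mathrm{Cl}(\Theta')$; join rules with premises $\Sigma_j;\Theta_j\rightarrow A_j$ ($1\le j\le n$, $n\ge1$): let $\Upsilon=\{A_1,\dots,A_n\}$, $\Sigma^{At}=\bigcup_j(\Sigma_j\cap\mathcal V)$, $\Sigma^{\supset}=\bigcup_j(\Sigma_j\cap\mathcal L^{\supset})$, $\Theta^{At}=\bigcap_j(\Theta_j\cap\mathcal V)$, $\Theta^{\supset}=\{Y\supset Z\in\bigcap_j(\Theta_j\cap\mathcal L^{\supset}):Y\in\Upsilon\}$, requiring $\Sigma_i\subseteq\Sigma_j\cup\Theta_j$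 ($i\ne j$) and ($Y\supset Z\in\Sigma^{\supset}\Rightarrow Y\in\Upsilon$); ($\bowtie^{At}$) conclusion $\Sigma^{At}\cup(\Theta^{At}\setminus\{F\})\cup\Sigma^{\supset}\cup\Theta^{\supset}\Rightarrow F$, $F\in\mathcal V_\bot\setminus\Sigma^{At}$, where each $Y\in\Upsilon$ has some $Y\supset Z\in\mathrm{Sl}(G)$; ($\bowtie^{\lor}$) conclusion $\Sigma^{At}\cup\Theta^{At}\cup\Sigma^{\supset}\cup\Theta^{\supset}\Rightarrow C_1\lor C_2$, $\{C_1,C_2\}\subseteq\Upsilon$, where each $Y\in\Upsilon$ has some $Y\supset Z\in\mathrm{Sl}(G)$ or $Y\lor Z\in\mathrm{Sr}(G)$ or $Z\lor Y\in\mathrm{Sr}(G)$. An $\mathbf{FRJ}(G)$-derivation of $G$ is a derivation of some regular sequent $\Gamma\Rightarrow G$. Write $\sigma_1\mapsto_0\sigma_2$ if some rule instance has conclusion $\sigma_2$ and $\sigma_1$ among its premises; $\mapsto$ is the transitive closure and $\mapsto_*$ the reflexive-transitive closure. For a derivation $\mathcal D$ of $G$, a p-sequent is a regular sequent occurring in $\mathcal D$ that is an axiom or the conclusion of a join rule; $\mathrm{Mod}(\mathcal D)=(P,\le,\rho,V)$ where $P$ is the set of p-sequents, $\sigma_1\le\sigma_2$ iff $\sigma_2\mapsto_*\sigma_1$, $\rho$ is the $\le$-minimum, $V(\sigma)=\mathrm{Lhs}(\sigma)\cap\mathcal V$, with standard intuitionistic Kripke forcing. The associated map $\phi$ sends each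 regular sequent $\sigma$ occurring in $\mathcal D$ to the p-sequent $\sigma_p$ with $\sigma_p\mapsto_*\sigma$ such that every p-sequent $\sigma'_p$ with $\sigma_p\mapsto_*\sigma'_p\mapsto_*\sigma$ equals $\sigma_p$. -}

module Defs where

open import Data.Nat using (ℕ)
open import Data.Bool using (Bool; true; false; T; _∨_; _∧_)
open import Data.Empty using (⊥)
open import Data.Unit using (⊤)
open import Data.Product using (Σ; Σ-syntax; ∃; ∃-syntax; _×_; _,_; proj₁; proj₂)
open import Data.Sum using (_⊎_; inj₁; inj₂)
open import Data.List using (List; []; _∷_; [_]; map; length; lookup)
open import Data.List.Relation.Unary.Any using (Any)
open import Data.List.Relation.Unary.All using (All)
open import Data.Fin using (Fin)
open import Relation.Binary.PropositionalEquality using (_≡_; _≢_)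
open import Relation.Nullary using (¬_)

infixr 6 _⋀_
infixr 5 _⋁_
infixr 4 _⊃_

data Fm : Set where
  var : ℕ → Fm
  ⊥f  : Fm
  _⋀_ _⋁_ _⊃_ : Fm → Fm → Fm

data IsVar : Fm → Set where
  isVar : ∀ n → IsVar (var n)

IsVar⊥ : Fm → Set
IsVar⊥ A = IsVar A ⊎ A ≡ ⊥f

data IsImp : Fm → Set where
  isImp : ∀ A B → IsImp (A ⊃ B)

-- Subformulas: Sf C A means A ∈ Sf(C); Sf⁻(C) = Sf(C) ∖ {C}
data Sf : Fm → Fm → Set where
  sf-refl : ∀ {C} → Sf C C
  sf-∧l : ∀ {A B X} → Sf A X → Sf (A ⋀ B) X
  sf-∧r : ∀ {A B X} → Sf B X → Sf (A ⋀ B) X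
  sf-∨l : ∀ {A B X} → Sf A X → Sf (A ⋁ B) X
  sf-∨r : ∀ {A B X} → Sf B X → Sf (A ⋁ B) X
  sf-⊃l : ∀ {A B X} → Sf A X → Sf (A ⊃ B) X
  sf-⊃r : ∀ {A B X} → Sf B X → Sf (A ⊃ B) X

Sf⁻ : Fm → Fm → Set
Sf⁻ C A = Sf C A × A ≢ C

mutual
  data Sl (G : Fm) : Fm → Set where
    sl-∧l : ∀ {A B} → Sl G (A ⋀ B) → Sl G A
    sl-∧r : ∀ {A B} → Sl G (A ⋀ B) → Sl G B
    sl-∨l : ∀ {A B} → Sl G (A ⋁ B) → Sl G A
    sl-∨r : ∀ {A B} → Sl G (A ⋁ B) → Sl G B
    sl-⊃r : ∀ {A B} → Sl G (A ⊃ B) → Sl G B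
    sl-⊃l : ∀ {A B} → Sr G (A ⊃ B) → Sl G A

  data Sr (G : Fm) : Fm → Set where
    sr-G  : Sr G G
    sr-∧l : ∀ {A B} → Sr G (A ⋀ B) → Sr G A
    sr-∧r : ∀ {A B} → Sr G (A ⋀ B) → Sr G B
    sr-∨l : ∀ {A B} → Sr G (A ⋁ B) → Sr G A
    sr-∨r : ∀ {A B} → Sr G (A ⋁ B) → Sr G B
    sr-⊃r : ∀ {A B} → Sr G (A ⊃ B) → Sr G B
    sr-⊃l : ∀ {A B} → Sl G (A ⊃ B) → Sr G A

ΓAt ΓImp Γbar : Fm → Fm → Set
ΓAt G A = Sl G A × IsVar A
ΓImp G A = Sl G A × IsImp A
Γbar G A = ΓAt G A ⊎ ΓImp G A

-- Finite sets of formulas, represented as decidable (Bool-valued)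
-- subsets of formulas; set equality is extensional.

FSet : Set
FSet = Fm → Bool

_∈_ : Fm → FSet → Set
A ∈ Γ = T (Γ A)

_∉_ : Fm → FSet → Set
A ∉ Γ = ¬ (A ∈ Γ)

∅ : FSet
∅ _ = false

_∪_ _∩_ : FSet → FSet → FSet
(Γ ∪ Δ) A = Γ A ∨ Δ A
(Γ ∩ Δ) A = Γ A ∧ Δ A

_⊆_ : FSet → FSet → Set
Γ ⊆ Δ = ∀ A → A ∈ Γ → A ∈ Δ

_⊂_ : FSet → FSet → Set
Γ ⊂ Δ = Γ ⊆ Δ × (∃[ A ] (A ∈ Δ × A ∉ Γ))

_≐_ : FSet → FSet → Set
Γ ≐ Δ = ∀ A → Γ A ≡ Δ A

_≐ₚ_ : FSet → (Fm → Set) → Set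
Γ ≐ₚ P = ∀ A → (A ∈ Γ → P A) × (P A → A ∈ Γ)

_⊆ₚ_ : FSet → (Fm → Set) → Set
Γ ⊆ₚ P = ∀ A → A ∈ Γ → P A

data Cl (Γ : FSet) : Fm → Set where
  cl-base : ∀ {X} → X ∈ Γ → Cl Γ X
  cl-∧ : ∀ {X Y} → Cl Γ X → Cl Γ Y → Cl Γ (X ⋀ Y)
  cl-∨r : ∀ {X} A → Cl Γ X → Cl Γ (A ⋁ X)
  cl-∨l : ∀ {X} A → Cl Γ X → Cl Γ (X ⋁ A)
  cl-⊃ : ∀ {X} A → Cl Γ X → Cl Γ (A ⊃ X)

infix 3 _⇒_ _︔_⟶_

data Seq : Set where
  _⇒_ : FSet → Fm → Seq
  _︔_⟶_ : FSet → FSet → Fm → Seq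

Lhs : Seq → FSet
Lhs (Γ ⇒ C) = Γ
Lhs (S ︔ Θ ⟶ C) = S ∪ Θ

Rhs : Seq → Fm
Rhs (Γ ⇒ C) = C
Rhs (S ︔ Θ ⟶ C) = C

IsRegular : Seq → Set
IsRegular (Γ ⇒ C) = ⊤
IsRegular (S ︔ Θ ⟶ C) = ⊥

data _≈_ : Seq → Seq → Set where
  reg≈ : ∀ {Γ Γ' C C'} → Γ ≐ Γ' → C ≡ C' → (Γ ⇒ C) ≈ (Γ' ⇒ C')
  irr≈ : ∀ {S S' Θ Θ' C C'} → S ≐ S' → Θ ≐ Θ' → C ≡ C' →
         (S ︔ Θ ⟶ C) ≈ (S' ︔ Θ' ⟶ C')

WF : Fm → Seq → Set
WF G σ = (Lhs σ ⊆ₚ Γbar G) × Sr G (Rhs σ)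

Prem : Set
Prem = FSet × FSet × Fm

pΣ pΘ : Prem → FSet
pΣ (S , Θ , A) = S
pΘ (S , Θ , A) = Θ

pA : Prem → Fm
pA (S , Θ , A) = A

toSeq : Prem → Seq
toSeq (S , Θ , A) = S ︔ Θ ⟶ A

module Join (ps : List Prem) where
  Υ : Fm → Set
  Υ Y = Any (λ q → pA q ≡ Y) ps

  ΣAt ΣImp ΘAt ΘImp : Fm → Set
  ΣAt A = IsVar A × Any (λ q → A ∈ pΣ q) ps
  ΣImp A = IsImp A × Any (λ q → A ∈ pΣ q) ps
  ΘAt A = IsVar A × All (λ q → A ∈ pΘ q) ps
  ΘImp A = Σ[ Y ∈ Fm ] Σ[ Z ∈ Fm ] (A ≡ (Y ⊃ Z) × All (λ q → A ∈ pΘ q) ps × Υ Y)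

  JoinCond : Set
  JoinCond = (∀ (i j : Fin (length ps)) → i ≢ j →
                 pΣ (lookup ps i) ⊆ (pΣ (lookup ps j) ∪ pΘ (lookup ps j)))
           × (∀ Y Z → ΣImp (Y ⊃ Z) → Υ Y)

data Rule (G : Fm) : List Seq → Seq → Set where
  ax-reg : ∀ {Γ F} → IsVar⊥ F →
           Γ ≐ₚ (λ A → ΓAt G A × A ≢ F) →
           Rule G [] (Γ ⇒ F)
  ax-irr : ∀ {Θ F} → IsVar⊥ F →
           Θ ≐ₚ (λ A → (ΓAt G A × A ≢ F) ⊎ ΓImp G A) →
           Rule G [] (∅ ︔ Θ ⟶ F)
  ∧-reg₁ : ∀ {Γ A₁ A₂} → Rule G [ Γ ⇒ A₁ ] (Γ ⇒ A₁ ⋀ A₂)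
  ∧-reg₂ : ∀ {Γ A₁ A₂} → Rule G [ Γ ⇒ A₂ ] (Γ ⇒ A₁ ⋀ A₂)
  ∧-irr₁ : ∀ {S Θ A₁ A₂} → Rule G [ S ︔ Θ ⟶ A₁ ] (S ︔ Θ ⟶ A₁ ⋀ A₂)
  ∧-irr₂ : ∀ {S Θ A₁ A₂} → Rule G [ S ︔ Θ ⟶ A₂ ] (S ︔ Θ ⟶ A₁ ⋀ A₂)
  ∨-rule : ∀ {S₁ Θ₁ C₁ S₂ Θ₂ C₂} →
           S₁ ⊆ (S₂ ∪ Θ₂) → S₂ ⊆ (S₁ ∪ Θ₁) →
           Rule G ((S₁ ︔ Θ₁ ⟶ C₁) ∷ (S₂ ︔ Θ₂ ⟶ C₂) ∷ [])
                  ((S₁ ∪ S₂) ︔ (Θ₁ ∩ Θ₂) ⟶ C₁ ⋁ C₂)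
  ⊃∈-reg : ∀ {Γ A B} → Cl Γ A → Rule G [ Γ ⇒ B ] (Γ ⇒ A ⊃ B)
  ⊃∈-irr : ∀ {S Θ Λ A B} →
           (∀ X → X ∈ Θ → X ∉ Λ) →
           Cl (S ∪ Λ) A →
           (∀ Λ' → Λ' ⊂ Λ → ¬ Cl (S ∪ Λ') A) →
           Rule G [ S ︔ (Θ ∪ Λ) ⟶ B ] ((S ∪ Λ) ︔ Θ ⟶ A ⊃ B)
  ⊃∉ : ∀ {Γ Θ A B} →
       Θ ⊆ₚ (λ X → Cl Γ X × Γbar G X) →
       Cl Γ A → ¬ Cl Θ A →
       (∀ Θ' → Θ ⊂ Θ' → Θ' ⊆ₚ (λ X → Cl Γ X × Γbar G X) → Cl Θ' A) →
       Rule G [ Γ ⇒ B ] (∅ ︔ Θ ⟶ A ⊃ B)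
  ⋈At : ∀ {Γ F} (ps : List Prem) → ps ≢ [] →
        let open Join ps in
        JoinCond →
        IsVar⊥ F → ¬ ΣAt F →
        (∀ Y → Υ Y → ∃[ Z ] Sl G (Y ⊃ Z)) →
        Γ ≐ₚ (λ A → ΣAt A ⊎ (ΘAt A × A ≢ F) ⊎ ΣImp A ⊎ ΘImp A) →
        Rule G (map toSeq ps) (Γ ⇒ F)
  ⋈∨ : ∀ {Γ C₁ C₂} (ps : List Prem) → ps ≢ [] →
       let open Join ps in
       JoinCond →
       Υ C₁ → Υ C₂ →
       (∀ Y → Υ Y → (∃[ Z ] Sl G (Y ⊃ Z)) ⊎ (∃[ Z ] Sr G (Y ⋁ Z)) ⊎ (∃[ Z ] Sr G (Z ⋁ Y))) →
       Γ ≐ₚ (λ A → ΣAt A ⊎ ΘAt A ⊎ ΣImp A ⊎ ΘImp A) →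
       Rule G (map toSeq ps) (Γ ⇒ C₁ ⋁ C₂)

-- rules whose regular conclusions are p-sequents: axioms and join rules
IsPRule : ∀ {G ps σ} → Rule G ps σ → Set
IsPRule (ax-reg _ _) = ⊤
IsPRule (⋈At _ _ _ _ _ _ _) = ⊤
IsPRule (⋈∨ _ _ _ _ _ _ _) = ⊤
IsPRule _ = ⊥

-- Derivations (trees of rule instances). Each premise of a rule
-- instance is derived by a subderivation whose conclusion equals the
-- premise (as sequents, i.e. with sets compared extensionally).

mutual
  data Deriv (G : Fm) : Seq → Set where
    node : ∀ {ps σ} → Rule G ps σ → WF G σ → Prems G ps → Deriv G σ

  data Prems (G : Fm) : List Seq → Set where
    []  : Prems G []
    cons : ∀ {p ps} (p' : Seq) → p' ≈ p → Deriv G p' → Prems G ps →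
           Prems G (p ∷ ps)

mutual
  data InstIn {G : Fm} {ps : List Seq} {σ : Seq} (r : Rule G ps σ) :
              ∀ {τ} → Deriv G τ → Set where
    here  : ∀ {w prs} → InstIn r (node r w prs)
    there : ∀ {qs τ} {r' : Rule G qs τ} {w} {prs : Prems G qs} →
            InstInPrems r prs → InstIn r (node r' w prs)

  data InstInPrems {G : Fm} {ps : List Seq} {σ : Seq} (r : Rule G ps σ) :
                   ∀ {qs} → Prems G qs → Set where
    hd : ∀ {q qs p' e} {d : Deriv G p'} {prs : Prems G qs} →
         InstIn r d → InstInPrems r (cons {p = q} p' e d prs)
    tl : ∀ {q qs p' e} {d : Deriv G p'} {prs : Prems G qs} →
         InstInPrems r prs → InstInPrems r (cons {p = q} p' e d prs)

module InDerivation {G : Fm} {σ₀ : Seq} (D : Deriv G σ₀) where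

  Occ : Seq → Set
  Occ σ = Σ[ ps ∈ List Seq ] Σ[ σ' ∈ Seq ] Σ[ r ∈ Rule G ps σ' ] (InstIn r D × σ' ≈ σ)

  _↦₀_ : Seq → Seq → Set
  σ₁ ↦₀ σ₂ = Σ[ ps ∈ List Seq ] Σ[ σ' ∈ Seq ] Σ[ r ∈ Rule G ps σ' ]
               (InstIn r D × σ' ≈ σ₂ × Any (λ p → p ≈ σ₁) ps)

  data _↦_ : Seq → Seq → Set where
    step : ∀ {a b} → a ↦₀ b → a ↦ b
    _◅_ : ∀ {a b c} → a ↦₀ b → b ↦ c → a ↦ c

  _↦*_ : Seq → Seq → Set
  a ↦* b = a ≈ b ⊎ a ↦ b

  IsP : Seq → Set
  IsP σ = IsRegular σ ×
          (Σ[ ps ∈ List Seq ] Σ[ σ' ∈ Seq ] Σ[ r ∈ Rule G ps σ' ]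
             (InstIn r D × IsPRule r × σ' ≈ σ))

  _≤_ : Seq → Seq → Set
  σ₁ ≤ σ₂ = σ₂ ↦* σ₁

  _⊩_ : Seq → Fm → Set
  σ ⊩ var n = var n ∈ Lhs σ
  σ ⊩ ⊥f = ⊥
  σ ⊩ (A ⋀ B) = (σ ⊩ A) × (σ ⊩ B)
  σ ⊩ (A ⋁ B) = (σ ⊩ A) ⊎ (σ ⊩ B)
  σ ⊩ (A ⊃ B) = ∀ σ' → IsP σ' → σ ≤ σ' → σ' ⊩ A → σ' ⊩ B

  IsPhi : Seq → Seq → Set
  IsPhi σ σp = IsP σp × σp ↦* σ ×
               (∀ σ' → IsP σ' → σp ↦* σ' → σ' ↦* σ → σ' ≈ σp)

module Submission where

-- Both parts come from a simultaneous induction on the formula A of two facts: every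
-- p-sequent forces A when A is in its antecedent, and (ii) holds for right formula A.
-- Along ↦ antecedents only shrink up to Cl, which makes forcing persistent. For A = Y ⊃ Z
-- in the antecedent of a p-sequent, every p-sequent above it either has Z in the closure
-- of its antecedent, or still contains Y ⊃ Z, in which case Y is the right formula of a
-- premise of its join and is refuted there by (ii). Axioms and joins refute their right
-- formula, and the rules (∧) and (⊃∈) pass refutation down; this handles the rule (⊃∉)
-- in (ii) and, walking back from σ to φ(σ), part (i).

open import Defs
open import Data.Nat as ℕ using (ℕ; suc; _+_; s≤s)
import Data.Nat.Properties as ℕₚ
open import Data.Nat.Induction using (<-wellFounded)
open import Data.Bool using (T; _∨_)
open import Data.Bool.Properties using (T-∨; T-∧)
open import Data.Empty using (⊥-elim)
open import Data.Unit using (tt)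
open import Data.Product using (Σ-syntax; ∃-syntax; _×_; _,_; proj₁; proj₂)
open import Data.Sum using (_⊎_; inj₁; inj₂; [_,_]′)
import Data.Sum as Sum
open import Data.List using (List; [_]; map; lookup)
open import Data.List.Relation.Unary.Any using (Any; here; there)
import Data.List.Relation.Unary.Any as Any
open import Data.List.Relation.Unary.All using (All)
import Data.List.Relation.Unary.All as All
import Data.List.Relation.Unary.Any.Properties as Anyₚ
open import Data.List.Membership.Propositional using (find; lose) renaming (_∈_ to _∈ₗ_)
open import Data.List.Membership.Propositional.Properties using (∈-map⁺; ∈-lookup)
import Data.Fin.Properties as Fin
open import Function using (_∘_; id; flip; Equivalence)
open import Induction.WellFounded using (Acc; acc; WellFounded; WfRec; module Subrelation)
import Induction.WellFounded as WF
import Relation.Binary.Construct.On as On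
open import Relation.Binary.Construct.Closure.ReflexiveTransitive using (Star; ε; _◅_; reverse)
open import Relation.Binary.PropositionalEquality using (_≡_; _≢_; refl; sym; trans; cong₂; subst)
open import Relation.Nullary using (¬_; yes; no)

module _ {Γ Δ : FSet} where

  ⊆-∪ˡ : Γ ⊆ (Γ ∪ Δ)
  ⊆-∪ˡ _ = Equivalence.from T-∨ ∘ inj₁

  ⊆-∪ʳ : Δ ⊆ (Γ ∪ Δ)
  ⊆-∪ʳ _ = Equivalence.from T-∨ ∘ inj₂

  ∈-∪⁻ : ∀ {A} → A ∈ (Γ ∪ Δ) → A ∈ Γ ⊎ A ∈ Δ
  ∈-∪⁻ = Equivalence.to T-∨

  ∪-least : ∀ {Ξ} → Γ ⊆ Ξ → Δ ⊆ Ξ → (Γ ∪ Δ) ⊆ Ξ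
  ∪-least Γ⊆Ξ Δ⊆Ξ A = [ Γ⊆Ξ A , Δ⊆Ξ A ]′ ∘ ∈-∪⁻

  ∩-⊆ˡ : (Γ ∩ Δ) ⊆ Γ
  ∩-⊆ˡ _ = proj₁ ∘ Equivalence.to T-∧

  ∩-⊆ʳ : (Γ ∩ Δ) ⊆ Δ
  ∩-⊆ʳ _ = proj₂ ∘ Equivalence.to T-∧

  ≐⇒⊆ : Γ ≐ Δ → Γ ⊆ Δ
  ≐⇒⊆ Γ≐Δ A = subst T (Γ≐Δ A)

≐-sym : ∀ {Γ Δ} → Γ ≐ Δ → Δ ≐ Γ
≐-sym Γ≐Δ A = sym (Γ≐Δ A)

≈-refl : ∀ {σ} → σ ≈ σ
≈-refl {Γ ⇒ C} = reg≈ (λ _ → refl) refl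
≈-refl {S ︔ Θ ⟶ C} = irr≈ (λ _ → refl) (λ _ → refl) refl

≈-sym : ∀ {σ τ} → σ ≈ τ → τ ≈ σ
≈-sym (reg≈ Γ≐ C≡) = reg≈ (≐-sym Γ≐) (sym C≡)
≈-sym (irr≈ S≐ Θ≐ C≡) = irr≈ (≐-sym S≐) (≐-sym Θ≐) (sym C≡)

≈-trans : ∀ {σ τ υ} → σ ≈ τ → τ ≈ υ → σ ≈ υ
≈-trans (reg≈ Γ≐ C≡) (reg≈ Γ≐′ C≡′) = reg≈ (λ A → trans (Γ≐ A) (Γ≐′ A)) (trans C≡ C≡′)
≈-trans (irr≈ S≐ Θ≐ C≡) (irr≈ S≐′ Θ≐′ C≡′) =
  irr≈ (λ A → trans (S≐ A) (S≐′ A)) (λ A → trans (Θ≐ A) (Θ≐′ A)) (trans C≡ C≡′)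

≈⇒Lhs-≐ : ∀ {σ τ} → σ ≈ τ → Lhs σ ≐ Lhs τ
≈⇒Lhs-≐ (reg≈ Γ≐ _) = Γ≐
≈⇒Lhs-≐ (irr≈ S≐ Θ≐ _) A = cong₂ _∨_ (S≐ A) (Θ≐ A)

Cl-trans : ∀ {Γ Δ A} → Γ ⊆ₚ Cl Δ → Cl Γ A → Cl Δ A
Cl-trans Γ⊆ (cl-base A∈Γ) = Γ⊆ _ A∈Γ
Cl-trans Γ⊆ (cl-∧ c d) = cl-∧ (Cl-trans Γ⊆ c) (Cl-trans Γ⊆ d)
Cl-trans Γ⊆ (cl-∨r A c) = cl-∨r A (Cl-trans Γ⊆ c)
Cl-trans Γ⊆ (cl-∨l A c) = cl-∨l A (Cl-trans Γ⊆ c)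
Cl-trans Γ⊆ (cl-⊃ A c) = cl-⊃ A (Cl-trans Γ⊆ c)

Cl-var⁻ : ∀ {Γ n} → Cl Γ (var n) → var n ∈ Γ
Cl-var⁻ (cl-base x) = x

Cl-resp-≈ : ∀ {σ τ A} → σ ≈ τ → Cl (Lhs σ) A → Cl (Lhs τ) A
Cl-resp-≈ σ≈τ = Cl-trans (λ X → cl-base ∘ ≐⇒⊆ (≈⇒Lhs-≐ σ≈τ) X)

-- The subformula order

infix 3 _⊑_ _⊏_

_⊑_ _⊏_ : Fm → Fm → Set
A ⊑ C = Sf C A
A ⊏ C = Sf⁻ C A

⊑-trans : ∀ {X A C} → X ⊑ A → A ⊑ C → X ⊑ C
⊑-trans X⊑A sf-refl = X⊑A
⊑-trans X⊑A (sf-∧l s) = sf-∧l (⊑-trans X⊑A s)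
⊑-trans X⊑A (sf-∧r s) = sf-∧r (⊑-trans X⊑A s)
⊑-trans X⊑A (sf-∨l s) = sf-∨l (⊑-trans X⊑A s)
⊑-trans X⊑A (sf-∨r s) = sf-∨r (⊑-trans X⊑A s)
⊑-trans X⊑A (sf-⊃l s) = sf-⊃l (⊑-trans X⊑A s)
⊑-trans X⊑A (sf-⊃r s) = sf-⊃r (⊑-trans X⊑A s)

⋀-⊏ˡ : ∀ {A B} → A ⊏ A ⋀ B
⋀-⊏ˡ = sf-∧l sf-refl , λ ()

⋀-⊏ʳ : ∀ {A B} → B ⊏ A ⋀ B
⋀-⊏ʳ = sf-∧r sf-refl , λ ()

⋁-⊏ˡ : ∀ {A B} → A ⊏ A ⋁ B
⋁-⊏ˡ = sf-∨l sf-refl , λ ()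

⋁-⊏ʳ : ∀ {A B} → B ⊏ A ⋁ B
⋁-⊏ʳ = sf-∨r sf-refl , λ ()

⊃-⊏ˡ : ∀ {A B} → A ⊏ A ⊃ B
⊃-⊏ˡ = sf-⊃l sf-refl , λ ()

⊃-⊏ʳ : ∀ {A B} → B ⊏ A ⊃ B
⊃-⊏ʳ = sf-⊃r sf-refl , λ ()

size : Fm → ℕ
size (var _) = 0
size ⊥f = 0
size (A ⋀ B) = suc (size A + size B)
size (A ⋁ B) = suc (size A + size B)
size (A ⊃ B) = suc (size A + size B)

private
  ≤⇒<-left : ∀ {n a b} → n ℕ.≤ a → n ℕ.< suc (a + b)
  ≤⇒<-left n≤a = s≤s (ℕₚ.≤-trans n≤a (ℕₚ.m≤m+n _ _))

  ≤⇒<-right : ∀ {n a b} → n ℕ.≤ b → n ℕ.< suc (a + b)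
  ≤⇒<-right n≤b = s≤s (ℕₚ.≤-trans n≤b (ℕₚ.m≤n+m _ _))

⊑⇒size≤ : ∀ {X A} → X ⊑ A → size X ℕ.≤ size A
⊑⇒size≤ sf-refl = ℕₚ.≤-refl
⊑⇒size≤ (sf-∧l s) = ℕₚ.<⇒≤ (≤⇒<-left (⊑⇒size≤ s))
⊑⇒size≤ (sf-∧r s) = ℕₚ.<⇒≤ (≤⇒<-right (⊑⇒size≤ s))
⊑⇒size≤ (sf-∨l s) = ℕₚ.<⇒≤ (≤⇒<-left (⊑⇒size≤ s))
⊑⇒size≤ (sf-∨r s) = ℕₚ.<⇒≤ (≤⇒<-right (⊑⇒size≤ s))
⊑⇒size≤ (sf-⊃l s) = ℕₚ.<⇒≤ (≤⇒<-left (⊑⇒size≤ s))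
⊑⇒size≤ (sf-⊃r s) = ℕₚ.<⇒≤ (≤⇒<-right (⊑⇒size≤ s))

⊏⇒size< : ∀ {X A} → X ⊏ A → size X ℕ.< size A
⊏⇒size< (sf-refl , X≢X) = ⊥-elim (X≢X refl)
⊏⇒size< (sf-∧l s , _) = ≤⇒<-left (⊑⇒size≤ s)
⊏⇒size< (sf-∧r s , _) = ≤⇒<-right (⊑⇒size≤ s)
⊏⇒size< (sf-∨l s , _) = ≤⇒<-left (⊑⇒size≤ s)
⊏⇒size< (sf-∨r s , _) = ≤⇒<-right (⊑⇒size≤ s)
⊏⇒size< (sf-⊃l s , _) = ≤⇒<-left (⊑⇒size≤ s)
⊏⇒size< (sf-⊃r s , _) = ≤⇒<-right (⊑⇒size≤ s)

⊑-⊏-trans : ∀ {X A C} → X ⊑ A → A ⊏ C → X ⊏ C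
⊑-⊏-trans X⊑A A⊏C = ⊑-trans X⊑A (proj₁ A⊏C) , λ { refl → ℕₚ.<⇒≱ (⊏⇒size< A⊏C) (⊑⇒size≤ X⊑A) }

⊏-trans : ∀ {X A C} → X ⊏ A → A ⊏ C → X ⊏ C
⊏-trans (X⊑A , _) = ⊑-⊏-trans X⊑A

⊏-wellFounded : WellFounded _⊏_
⊏-wellFounded = Subrelation.wellFounded ⊏⇒size< (On.wellFounded size <-wellFounded)

module _ {ps : List Prem} where
  open Join ps

  JoinAntecedent : FSet → Set
  JoinAntecedent Γ = (∀ A → ΣAt A ⊎ ΣImp A → A ∈ Γ)
                   × (∀ A → A ∈ Γ → ΣAt A ⊎ ΘAt A ⊎ ΣImp A ⊎ ΘImp A)

  ⋈At-antecedent : ∀ {Γ F} → Γ ≐ₚ (λ A → ΣAt A ⊎ (ΘAt A × A ≢ F) ⊎ ΣImp A ⊎ ΘImp A) →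
                   JoinAntecedent Γ
  ⋈At-antecedent {Γ} Γ≐ = Σ⊆Γ , Γ⊆
    where
    Σ⊆Γ : ∀ A → ΣAt A ⊎ ΣImp A → A ∈ Γ
    Σ⊆Γ A (inj₁ x) = proj₂ (Γ≐ A) (inj₁ x)
    Σ⊆Γ A (inj₂ x) = proj₂ (Γ≐ A) (inj₂ (inj₂ (inj₁ x)))
    Γ⊆ : ∀ A → A ∈ Γ → ΣAt A ⊎ ΘAt A ⊎ ΣImp A ⊎ ΘImp A
    Γ⊆ A x = Sum.map₂ (Sum.map₁ proj₁) (proj₁ (Γ≐ A) x)

  ⋈∨-antecedent : ∀ {Γ} → Γ ≐ₚ (λ A → ΣAt A ⊎ ΘAt A ⊎ ΣImp A ⊎ ΘImp A) → JoinAntecedent Γ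
  ⋈∨-antecedent {Γ} Γ≐ = Σ⊆Γ , λ A → proj₁ (Γ≐ A)
    where
    Σ⊆Γ : ∀ A → ΣAt A ⊎ ΣImp A → A ∈ Γ
    Σ⊆Γ A (inj₁ x) = proj₂ (Γ≐ A) (inj₁ x)
    Σ⊆Γ A (inj₂ x) = proj₂ (Γ≐ A) (inj₂ (inj₂ (inj₁ x)))

  join-antecedent-⊃ : ∀ {Γ Y Z} → JoinCond → JoinAntecedent Γ → (Y ⊃ Z) ∈ Γ → Υ Y
  join-antecedent-⊃ (_ , Σ⊃⇒Υ) (_ , Γ⊆) h with Γ⊆ _ h
  ... | inj₂ (inj₂ (inj₁ x)) = Σ⊃⇒Υ _ _ x
  ... | inj₂ (inj₂ (inj₂ (_ , _ , refl , _ , u))) = u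

  Σ-⊆-premise : JoinCond → ∀ j {A} → Any (λ q → A ∈ pΣ q) ps → A ∈ Lhs (toSeq (lookup ps j))
  Σ-⊆-premise (Σ⊆ , _) j {A} inΣ with Any.index inΣ Fin.≟ j
  ... | yes refl = ⊆-∪ˡ {pΣ (lookup ps j)} {pΘ (lookup ps j)} A (Anyₚ.lookup-index inΣ)
  ... | no i≢j = Σ⊆ (Any.index inΣ) j i≢j A (Anyₚ.lookup-index inΣ)

  Θ-⊆-premise : ∀ j {A} → All (λ q → A ∈ pΘ q) ps → A ∈ Lhs (toSeq (lookup ps j))
  Θ-⊆-premise j {A} inΘ = ⊆-∪ʳ {pΣ (lookup ps j)} {pΘ (lookup ps j)} A (All.lookup inΘ (∈-lookup j))

  join-antecedent-⊆-premise : ∀ {Γ} → JoinCond → JoinAntecedent Γ →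
                              ∀ j → Γ ⊆ Lhs (toSeq (lookup ps j))
  join-antecedent-⊆-premise jc (_ , Γ⊆) j A x with Γ⊆ A x
  ... | inj₁ (_ , inΣ) = Σ-⊆-premise jc j inΣ
  ... | inj₂ (inj₁ (_ , inΘ)) = Θ-⊆-premise j inΘ
  ... | inj₂ (inj₂ (inj₁ (_ , inΣ))) = Σ-⊆-premise jc j inΣ
  ... | inj₂ (inj₂ (inj₂ (_ , _ , _ , inΘ , _))) = Θ-⊆-premise j inΘ

  join-Lhs : ∀ {Γ a} → JoinCond → JoinAntecedent Γ → Any (λ p → p ≈ a) (map toSeq ps) →
             Γ ⊆ₚ Cl (Lhs a)
  join-Lhs jc ant q≈a A x =
    Cl-resp-≈ (Anyₚ.lookup-index (Anyₚ.map⁻ q≈a))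
              (cl-base (join-antecedent-⊆-premise jc ant (Any.index (Anyₚ.map⁻ q≈a)) A x))

private
  through : ∀ {Γ p a} → p ≈ a → Γ ⊆ Lhs p → Γ ⊆ₚ Cl (Lhs a)
  through p≈a Γ⊆p A = Cl-resp-≈ p≈a ∘ cl-base ∘ Γ⊆p A

Rule-Lhs : ∀ {G ps σ a} → Rule G ps σ → Any (λ p → p ≈ a) ps → Lhs σ ⊆ₚ Cl (Lhs a)
Rule-Lhs ∧-reg₁ (here p≈a) = through p≈a λ _ x → x
Rule-Lhs ∧-reg₂ (here p≈a) = through p≈a λ _ x → x
Rule-Lhs ∧-irr₁ (here p≈a) = through p≈a λ _ x → x
Rule-Lhs ∧-irr₂ (here p≈a) = through p≈a λ _ x → x
Rule-Lhs (∨-rule {S₁} {Θ₁} {_} {S₂} {Θ₂} _ S₂⊆) (here p≈a) =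
  through p≈a (∪-least (∪-least (⊆-∪ˡ {S₁} {Θ₁}) S₂⊆) (λ A → ⊆-∪ʳ {S₁} {Θ₁} A ∘ ∩-⊆ˡ {Θ₁} {Θ₂} A))
Rule-Lhs (∨-rule {S₁} {Θ₁} {_} {S₂} {Θ₂} S₁⊆ _) (there (here p≈a)) =
  through p≈a (∪-least (∪-least S₁⊆ (⊆-∪ˡ {S₂} {Θ₂})) (λ A → ⊆-∪ʳ {S₂} {Θ₂} A ∘ ∩-⊆ʳ {Θ₁} {Θ₂} A))
Rule-Lhs (⊃∈-reg _) (here p≈a) = through p≈a λ _ x → x
Rule-Lhs (⊃∈-irr {S} {Θ} {Λ} _ _ _) (here p≈a) =
  through p≈a (∪-least (∪-least (⊆-∪ˡ {S}) (λ A → ⊆-∪ʳ {S} {Θ ∪ Λ} A ∘ ⊆-∪ʳ {Θ} {Λ} A))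
                       (λ A → ⊆-∪ʳ {S} {Θ ∪ Λ} A ∘ ⊆-∪ˡ {Θ} {Λ} A))
Rule-Lhs (⊃∉ {Θ = Θ} Θ⊆ _ _ _) (here p≈a) A x with ∈-∪⁻ {∅} {Θ} x
... | inj₂ A∈Θ = Cl-resp-≈ p≈a (proj₁ (Θ⊆ A A∈Θ))
Rule-Lhs (⋈At ps _ jc _ _ _ Γ≐) = join-Lhs jc (⋈At-antecedent Γ≐)
Rule-Lhs (⋈∨ ps _ jc _ _ _ Γ≐) = join-Lhs jc (⋈∨-antecedent Γ≐)

-- The regular rules (∧) and (⊃∈), whose premise has the antecedent of the conclusion.
data RightIntro (Γ : FSet) : Fm → Fm → Set where
  ⋀-introˡ : ∀ {A₁ A₂} → RightIntro Γ A₁ (A₁ ⋀ A₂)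
  ⋀-introʳ : ∀ {A₁ A₂} → RightIntro Γ A₂ (A₁ ⋀ A₂)
  ⊃-intro : ∀ {A B} → Cl Γ A → RightIntro Γ B (A ⊃ B)

RightIntro⇒⊏ : ∀ {Γ C′ C} → RightIntro Γ C′ C → C′ ⊏ C
RightIntro⇒⊏ ⋀-introˡ = ⋀-⊏ˡ
RightIntro⇒⊏ ⋀-introʳ = ⋀-⊏ʳ
RightIntro⇒⊏ (⊃-intro _) = ⊃-⊏ʳ

regular-rule-view : ∀ {G ps Γ C} (r : Rule G ps (Γ ⇒ C)) →
                    IsPRule r ⊎ ∃[ C′ ] (RightIntro Γ C′ C × ps ≡ [ Γ ⇒ C′ ])
regular-rule-view (ax-reg _ _) = inj₁ tt
regular-rule-view ∧-reg₁ = inj₂ (_ , ⋀-introˡ , refl)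
regular-rule-view ∧-reg₂ = inj₂ (_ , ⋀-introʳ , refl)
regular-rule-view (⊃∈-reg A∈ClΓ) = inj₂ (_ , ⊃-intro A∈ClΓ , refl)
regular-rule-view (⋈At _ _ _ _ _ _ _) = inj₁ tt
regular-rule-view (⋈∨ _ _ _ _ _ _ _) = inj₁ tt

mutual
  InstIn-node : ∀ {G ps σ} {r : Rule G ps σ} {τ} {d : Deriv G τ} → InstIn r d →
                Σ[ w ∈ WF G σ ] Σ[ prs ∈ Prems G ps ]
                  (∀ {qs υ} {r′ : Rule G qs υ} → InstIn r′ (node r w prs) → InstIn r′ d)
  InstIn-node here = _ , _ , λ i → i
  InstIn-node (there i) with InstInPrems-node i
  ... | w , prs , embed = w , prs , there ∘ embed

  InstInPrems-node : ∀ {G ps σ} {r : Rule G ps σ} {qs} {prs₀ : Prems G qs} → InstInPrems r prs₀ →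
                     Σ[ w ∈ WF G σ ] Σ[ prs ∈ Prems G ps ]
                       (∀ {qs′ υ} {r′ : Rule G qs′ υ} → InstIn r′ (node r w prs) → InstInPrems r′ prs₀)
  InstInPrems-node (hd i) with InstIn-node i
  ... | w , prs , embed = w , prs , hd ∘ embed
  InstInPrems-node (tl i) with InstInPrems-node i
  ... | w , prs , embed = w , prs , tl ∘ embed

-- The model extracted from a derivation

module ExtractedModel {G : Fm} {σ₀ : Seq} (D : Deriv G σ₀) where
  open InDerivation D

  private
    Prems-occur : ∀ {qs} (prs : Prems G qs) →
                  (∀ {qs′ υ} {r : Rule G qs′ υ} → InstInPrems r prs → InstIn r D) →
                  ∀ {p} → p ∈ₗ qs → Occ p
    Prems-occur (cons p′ p′≈p (node r _ _) _) embed (here refl) = _ , p′ , r , embed (hd here) , p′≈p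
    Prems-occur (cons _ _ _ prs) embed (there p∈qs) = Prems-occur prs (embed ∘ tl) p∈qs

  premise-occurs : ∀ {ps σ} {r : Rule G ps σ} → InstIn r D → ∀ {p} → p ∈ₗ ps → Occ p
  premise-occurs i = let _ , prs , embed = InstIn-node i in Prems-occur prs (embed ∘ there)

  Occ-Lhs-shape : ∀ {σ A} → Occ σ → A ∈ Lhs σ → IsVar A ⊎ IsImp A
  Occ-Lhs-shape (_ , _ , _ , i , σ′≈σ) A∈σ =
    Sum.map proj₂ proj₂ (proj₁ (proj₁ (InstIn-node i)) _ (≐⇒⊆ (≐-sym (≈⇒Lhs-≐ σ′≈σ)) _ A∈σ))

  IsP⇒Occ : ∀ {σ} → IsP σ → Occ σ
  IsP⇒Occ (_ , ps , σ′ , r , i , _ , σ′≈σ) = ps , σ′ , r , i , σ′≈σ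

  instance-IsP : ∀ {ps Γ C} {r : Rule G ps (Γ ⇒ C)} → InstIn r D → IsPRule r → IsP (Γ ⇒ C)
  instance-IsP {r = r} i pr = tt , _ , _ , r , i , pr , ≈-refl

  premise-↦₀ : ∀ {ps σ} {r : Rule G ps σ} → InstIn r D → ∀ {p} → p ∈ₗ ps → p ↦₀ σ
  premise-↦₀ {r = r} i p∈ps = _ , _ , r , i , ≈-refl , Any.map (λ { refl → ≈-refl }) p∈ps

  ↦₀-respˡ-≈ : ∀ {a a′ b} → a′ ≈ a → a ↦₀ b → a′ ↦₀ b
  ↦₀-respˡ-≈ a′≈a (ps , σ , r , i , σ≈b , p≈a) =
    ps , σ , r , i , σ≈b , Any.map (λ p≈a → ≈-trans p≈a (≈-sym a′≈a)) p≈a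

  ↦₀-respʳ-≈ : ∀ {a b b′} → b ≈ b′ → a ↦₀ b → a ↦₀ b′
  ↦₀-respʳ-≈ b≈b′ (ps , σ , r , i , σ≈b , p≈a) = ps , σ , r , i , ≈-trans σ≈b b≈b′ , p≈a

  ↦-respˡ-≈ : ∀ {a a′ b} → a′ ≈ a → a ↦ b → a′ ↦ b
  ↦-respˡ-≈ a′≈a (step s) = step (↦₀-respˡ-≈ a′≈a s)
  ↦-respˡ-≈ a′≈a (s ◅ p) = ↦₀-respˡ-≈ a′≈a s ◅ p

  ↦-respʳ-≈ : ∀ {a b b′} → b ≈ b′ → a ↦ b → a ↦ b′
  ↦-respʳ-≈ b≈b′ (step s) = step (↦₀-respʳ-≈ b≈b′ s)
  ↦-respʳ-≈ b≈b′ (s ◅ p) = s ◅ ↦-respʳ-≈ b≈b′ p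

  ↦-trans : ∀ {a b c} → a ↦ b → b ↦ c → a ↦ c
  ↦-trans (step s) q = s ◅ q
  ↦-trans (s ◅ p) q = s ◅ ↦-trans p q

  ↦*-↦-trans : ∀ {a b c} → a ↦* b → b ↦ c → a ↦ c
  ↦*-↦-trans (inj₁ a≈b) = ↦-respˡ-≈ a≈b
  ↦*-↦-trans (inj₂ p) = ↦-trans p

  ↦*-trans : ∀ {a b c} → a ↦* b → b ↦* c → a ↦* c
  ↦*-trans (inj₁ a≈b) (inj₁ b≈c) = inj₁ (≈-trans a≈b b≈c)
  ↦*-trans (inj₂ p) (inj₁ b≈c) = inj₂ (↦-respʳ-≈ b≈c p)
  ↦*-trans p (inj₂ q) = inj₂ (↦*-↦-trans p q)

  ↦*-snoc : ∀ {a b c} → a ↦* b → b ↦₀ c → a ↦* c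
  ↦*-snoc p s = ↦*-trans p (inj₂ (step s))

  ↦₀-Lhs : ∀ {a b} → a ↦₀ b → Lhs b ⊆ₚ Cl (Lhs a)
  ↦₀-Lhs (_ , _ , r , _ , σ≈b , p≈a) A = Rule-Lhs r p≈a A ∘ ≐⇒⊆ (≐-sym (≈⇒Lhs-≐ σ≈b)) A

  ↦-Lhs : ∀ {a b} → a ↦ b → Lhs b ⊆ₚ Cl (Lhs a)
  ↦-Lhs (step s) = ↦₀-Lhs s
  ↦-Lhs (s ◅ p) A = Cl-trans (↦₀-Lhs s) ∘ ↦-Lhs p A

  ↦*-Lhs : ∀ {a b} → a ↦* b → Lhs b ⊆ₚ Cl (Lhs a)
  ↦*-Lhs (inj₁ a≈b) A = cl-base ∘ ≐⇒⊆ (≐-sym (≈⇒Lhs-≐ a≈b)) A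
  ↦*-Lhs (inj₂ p) = ↦-Lhs p

  ≤-trans : ∀ {σ₁ σ₂ σ₃} → σ₁ ≤ σ₂ → σ₂ ≤ σ₃ → σ₁ ≤ σ₃
  ≤-trans σ₂↦σ₁ σ₃↦σ₂ = ↦*-trans σ₃↦σ₂ σ₂↦σ₁

  ⊩-mono : ∀ A {σ₁ σ₂} → σ₁ ≤ σ₂ → σ₁ ⊩ A → σ₂ ⊩ A
  ⊩-mono (var n) σ₂↦σ₁ h = Cl-var⁻ (↦*-Lhs σ₂↦σ₁ (var n) h)
  ⊩-mono ⊥f _ ()
  ⊩-mono (A ⋀ B) σ₁≤σ₂ (a , b) = ⊩-mono A σ₁≤σ₂ a , ⊩-mono B σ₁≤σ₂ b
  ⊩-mono (A ⋁ B) σ₁≤σ₂ = Sum.map (⊩-mono A σ₁≤σ₂) (⊩-mono B σ₁≤σ₂)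
  ⊩-mono (A ⊃ B) σ₁≤σ₂ h σ isP σ₂≤σ = h σ isP (≤-trans σ₁≤σ₂ σ₂≤σ)

  ⊩-resp-≈ : ∀ {A σ₁ σ₂} → σ₁ ≈ σ₂ → σ₁ ⊩ A → σ₂ ⊩ A
  ⊩-resp-≈ {A} σ₁≈σ₂ = ⊩-mono A (inj₁ (≈-sym σ₁≈σ₂))

  Cl-forced : ∀ {σ Γ A} → Cl Γ A → (∀ X → X ∈ Γ → X ⊑ A → σ ⊩ X) → σ ⊩ A
  Cl-forced (cl-base A∈Γ) forced = forced _ A∈Γ sf-refl
  Cl-forced (cl-∧ c d) forced =
    Cl-forced c (λ X x → forced X x ∘ sf-∧l) , Cl-forced d (λ X x → forced X x ∘ sf-∧r)
  Cl-forced (cl-∨r _ c) forced = inj₂ (Cl-forced c (λ X x → forced X x ∘ sf-∨r))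
  Cl-forced (cl-∨l _ c) forced = inj₁ (Cl-forced c (λ X x → forced X x ∘ sf-∨l))
  Cl-forced (cl-⊃ {X} _ c) forced _ _ σ≤σ′ _ = ⊩-mono X σ≤σ′ (Cl-forced c (λ Y y → forced Y y ∘ sf-⊃r))

  LhsForced : Fm → Set
  LhsForced A = ∀ τ → IsP τ → A ∈ Lhs τ → τ ⊩ A

  IrregularRefutes : Fm → Set
  IrregularRefutes C = ∀ S Θ → Occ (S ︔ Θ ⟶ C) → ∀ σp → IsP σp → (S ︔ Θ ⟶ C) ↦ σp →
                       (∀ A → A ∈ S → Sf⁻ C A → σp ⊩ A) → ¬ (σp ⊩ C)

  Adequate : Fm → Set
  Adequate A = LhsForced A × IrregularRefutes A

  Cl-Lhs-forced : ∀ {τ A} → IsP τ → (∀ {X} → X ⊑ A → LhsForced X) → Cl (Lhs τ) A → τ ⊩ A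
  Cl-Lhs-forced isP lhsForced c = Cl-forced c (λ X x X⊑A → lhsForced X⊑A _ isP x)

  premise-Σ-⊆ : ∀ {ps σ} {r : Rule G (map toSeq ps) σ} → InstIn r D → ∀ {q} → q ∈ₗ ps →
                ∀ A → A ∈ pΣ q → Join.ΣAt ps A ⊎ Join.ΣImp ps A
  premise-Σ-⊆ i {q} q∈ps A A∈Σ =
    Sum.map (_, lose q∈ps A∈Σ) (_, lose q∈ps A∈Σ)
            (Occ-Lhs-shape (premise-occurs i (∈-map⁺ toSeq q∈ps)) (⊆-∪ˡ {pΣ q} {pΘ q} A A∈Σ))

  -- Each premise Σⱼ ; Θⱼ → Y of a join leads to its conclusion, which forces Σⱼ.
  Υ-refuted : ∀ {ps Γ C E Y} (r : Rule G (map toSeq ps) (Γ ⇒ C)) → InstIn r D → IsPRule r →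
              (∀ A → Join.ΣAt ps A ⊎ Join.ΣImp ps A → A ∈ Γ) → Join.Υ ps Y →
              WfRec _⊏_ Adequate E → Y ⊏ E → ¬ (Γ ⇒ C) ⊩ Y
  Υ-refuted r i pr Σ⊆Γ Y∈Υ below Y⊏E with find Y∈Υ
  ... | (S , Θ , _) , q∈ps , refl =
    proj₂ (below Y⊏E) S Θ (premise-occurs i q∈) _ (instance-IsP i pr) (step (premise-↦₀ i q∈))
      (λ A A∈S A⊏Y → proj₁ (below (⊏-trans A⊏Y Y⊏E)) _ (instance-IsP i pr)
                       (Σ⊆Γ A (premise-Σ-⊆ i q∈ps A A∈S)))
    where q∈ = ∈-map⁺ toSeq q∈ps

  p-refutes : ∀ {ps Γ C} (r : Rule G ps (Γ ⇒ C)) → InstIn r D → IsPRule r →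
              WfRec _⊏_ Adequate C → ¬ (Γ ⇒ C) ⊩ C
  p-refutes (ax-reg (inj₁ (isVar n)) Γ≐) _ _ _ h = proj₂ (proj₁ (Γ≐ (var n)) h) refl
  p-refutes (ax-reg (inj₂ refl) _) _ _ _ ()
  p-refutes (⋈At _ _ _ (inj₂ refl) _ _ _) _ _ _ ()
  p-refutes (⋈At _ _ _ (inj₁ (isVar n)) F∉Σ _ Γ≐) _ _ _ h with proj₁ (Γ≐ (var n)) h
  ... | inj₁ F∈Σ = F∉Σ F∈Σ
  ... | inj₂ (inj₁ (_ , F≢F)) = F≢F refl
  ... | inj₂ (inj₂ (inj₁ (() , _)))
  ... | inj₂ (inj₂ (inj₂ (_ , _ , () , _)))
  p-refutes r@(⋈∨ _ _ _ C₁∈Υ _ _ Γ≐) i pr below (inj₁ h) =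
    Υ-refuted r i pr (proj₁ (⋈∨-antecedent Γ≐)) C₁∈Υ below ⋁-⊏ˡ h
  p-refutes r@(⋈∨ _ _ _ _ C₂∈Υ _ Γ≐) i pr below (inj₂ h) =
    Υ-refuted r i pr (proj₁ (⋈∨-antecedent Γ≐)) C₂∈Υ below ⋁-⊏ʳ h

  p-refutes-antecedent : ∀ {ps Γ C E Y Z} (r : Rule G ps (Γ ⇒ C)) → InstIn r D → IsPRule r →
                         (Y ⊃ Z) ∈ Γ → WfRec _⊏_ Adequate E → Y ⊏ E → ¬ (Γ ⇒ C) ⊩ Y
  p-refutes-antecedent (ax-reg _ Γ≐) _ _ h with proj₁ (Γ≐ _) h
  ... | (_ , ()) , _
  p-refutes-antecedent r@(⋈At _ _ jc _ _ _ Γ≐) i pr h =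
    Υ-refuted r i pr (proj₁ ant) (join-antecedent-⊃ jc ant h)
    where ant = ⋈At-antecedent Γ≐
  p-refutes-antecedent r@(⋈∨ _ _ jc _ _ _ Γ≐) i pr h =
    Υ-refuted r i pr (proj₁ ant) (join-antecedent-⊃ jc ant h)
    where ant = ⋈∨-antecedent Γ≐

  IsP-refutes-antecedent : ∀ {τ E Y Z} → IsP τ → (Y ⊃ Z) ∈ Lhs τ →
                           WfRec _⊏_ Adequate E → Y ⊏ E → ¬ τ ⊩ Y
  IsP-refutes-antecedent {_ ⇒ _} {Y = Y} (_ , _ , (_ ⇒ _) , r , i , pr , e@(reg≈ Γ′≐Γ refl)) h below Y⊏E =
    p-refutes-antecedent r i pr (≐⇒⊆ (≐-sym Γ′≐Γ) _ h) below Y⊏E ∘ ⊩-resp-≈ {Y} (≈-sym e)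
  IsP-refutes-antecedent {_ ︔ _ ⟶ _} (() , _)

  lhs-forced : ∀ A → WfRec _⊏_ Adequate A → LhsForced A
  lhs-forced A below τ isP h with Occ-Lhs-shape (IsP⇒Occ isP) h
  ... | inj₁ (isVar n) = h
  ... | inj₂ (isImp Y Z) = λ τ′ isP′ τ≤τ′ τ′⊩Y → forced τ′ isP′ (↦*-Lhs τ≤τ′ (Y ⊃ Z) h) τ′⊩Y
    where
    forced : ∀ τ′ → IsP τ′ → Cl (Lhs τ′) (Y ⊃ Z) → τ′ ⊩ Y → τ′ ⊩ Z
    forced τ′ isP′ (cl-⊃ _ Z∈Cl) _ =
      Cl-Lhs-forced isP′ (λ X⊑Z → proj₁ (below (⊑-⊏-trans X⊑Z ⊃-⊏ʳ))) Z∈Cl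
    forced τ′ isP′ (cl-base Y⊃Z∈τ′) τ′⊩Y =
      ⊥-elim (IsP-refutes-antecedent isP′ Y⊃Z∈τ′ below ⊃-⊏ˡ τ′⊩Y)

  refutation-descends : ∀ {Γ C′ C τ} → RightIntro Γ C′ C → WfRec _⊏_ LhsForced C →
                        IsP τ → τ ↦* (Γ ⇒ C′) → ¬ τ ⊩ C′ → ¬ τ ⊩ C
  refutation-descends ⋀-introˡ _ _ _ ¬C′ = ¬C′ ∘ proj₁
  refutation-descends ⋀-introʳ _ _ _ ¬C′ = ¬C′ ∘ proj₂
  refutation-descends (⊃-intro A∈ClΓ) below isP τ↦Γ ¬B h =
    ¬B (h _ isP (inj₁ ≈-refl)
          (Cl-Lhs-forced isP (λ X⊑A → below (⊑-⊏-trans X⊑A ⊃-⊏ˡ)) (Cl-trans (↦*-Lhs τ↦Γ) A∈ClΓ)))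

  RefutedAbove : Seq → Set
  RefutedAbove σ = ∃[ τ ] (IsP τ × τ ↦* σ × ¬ τ ⊩ Rhs σ)

  refuted-above : ∀ {Γ C} → Acc _⊏_ C → WfRec _⊏_ Adequate C → Occ (Γ ⇒ C) → RefutedAbove (Γ ⇒ C)
  refuted-above (acc rec) below (_ , (_ ⇒ _) , r , i , e@(reg≈ _ refl)) with regular-rule-view r
  ... | inj₁ pr = _ , instance-IsP i pr , inj₁ e , p-refutes r i pr below
  ... | inj₂ (C′ , intro , refl) =
    let C′⊏C = RightIntro⇒⊏ intro
        τ , isP , τ↦p , ¬C′ = refuted-above (rec C′⊏C) (λ X⊏C′ → below (⊏-trans X⊏C′ C′⊏C))
                                            (premise-occurs i (here refl))
    in τ , isP , ↦*-snoc τ↦p (_ , _ , r , i , e , here ≈-refl) ,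
       refutation-descends intro (proj₁ ∘ below) isP τ↦p ¬C′

  irregular-instance-refutes :
    ∀ {ps S Θ C} (r : Rule G ps (S ︔ Θ ⟶ C)) → InstIn r D → WfRec _⊏_ Adequate C →
    ∀ σp → IsP σp → (S ︔ Θ ⟶ C) ↦ σp → (∀ A → A ∈ S → A ⊏ C → σp ⊩ A) → ¬ σp ⊩ C
  irregular-instance-refutes (ax-irr (inj₂ refl) _) _ _ _ _ _ _ ()
  irregular-instance-refutes (ax-irr {Θ} (inj₁ (isVar n)) Θ≐) _ _ _ _ path _ h
    with ∈-∪⁻ {∅} {Θ} (Cl-var⁻ (↦-Lhs path (var n) h))
  ... | inj₂ F∈Θ with proj₁ (Θ≐ (var n)) F∈Θ
  ...   | inj₁ (_ , F≢F) = F≢F refl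
  ...   | inj₂ (_ , ())
  irregular-instance-refutes ∧-irr₁ i below σp isP path forced (h , _) =
    proj₂ (below ⋀-⊏ˡ) _ _ (premise-occurs i (here refl)) σp isP (premise-↦₀ i (here refl) ◅ path)
      (λ A A∈S A⊏A₁ → forced A A∈S (⊏-trans A⊏A₁ ⋀-⊏ˡ)) h
  irregular-instance-refutes ∧-irr₂ i below σp isP path forced (_ , h) =
    proj₂ (below ⋀-⊏ʳ) _ _ (premise-occurs i (here refl)) σp isP (premise-↦₀ i (here refl) ◅ path)
      (λ A A∈S A⊏A₂ → forced A A∈S (⊏-trans A⊏A₂ ⋀-⊏ʳ)) h
  irregular-instance-refutes (∨-rule {S₁} {_} {_} {S₂} _ _) i below σp isP path forced (inj₁ h) =
    proj₂ (below ⋁-⊏ˡ) _ _ (premise-occurs i (here refl)) σp isP (premise-↦₀ i (here refl) ◅ path)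
      (λ A A∈S₁ A⊏C₁ → forced A (⊆-∪ˡ {S₁} {S₂} A A∈S₁) (⊏-trans A⊏C₁ ⋁-⊏ˡ)) h
  irregular-instance-refutes (∨-rule {S₁} {_} {_} {S₂} _ _) i below σp isP path forced (inj₂ h) =
    proj₂ (below ⋁-⊏ʳ) _ _ (premise-occurs i (there (here refl))) σp isP
      (premise-↦₀ i (there (here refl)) ◅ path)
      (λ A A∈S₂ A⊏C₂ → forced A (⊆-∪ʳ {S₁} {S₂} A A∈S₂) (⊏-trans A⊏C₂ ⋁-⊏ʳ)) h
  irregular-instance-refutes (⊃∈-irr {S} {_} {Λ} _ A∈Cl _) i below σp isP path forced h =
    proj₂ (below ⊃-⊏ʳ) _ _ (premise-occurs i (here refl)) σp isP (premise-↦₀ i (here refl) ◅ path)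
      (λ X X∈S X⊏B → forced X (⊆-∪ˡ {S} {Λ} X X∈S) (⊏-trans X⊏B ⊃-⊏ʳ))
      (h σp isP (inj₁ ≈-refl) (Cl-forced A∈Cl (λ X X∈SΛ X⊑A → forced X X∈SΛ (⊑-⊏-trans X⊑A ⊃-⊏ˡ))))
  -- The p-sequent τ above the premise Γ ⇒ B refutes B, forces A ∈ Cl(Γ), and σp ≤ τ.
  irregular-instance-refutes (⊃∉ _ A∈ClΓ _ _) i below σp isP path _ h =
    let τ , isPτ , τ↦p , ¬B = refuted-above (⊏-wellFounded _) (λ X⊏B → below (⊏-trans X⊏B ⊃-⊏ʳ))
                                            (premise-occurs i (here refl))
    in ¬B (h τ isPτ (inj₂ (↦*-↦-trans τ↦p (premise-↦₀ i (here refl) ◅ path)))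
             (Cl-Lhs-forced isPτ (λ X⊑A → proj₁ (below (⊑-⊏-trans X⊑A ⊃-⊏ˡ)))
                            (Cl-trans (↦*-Lhs τ↦p) A∈ClΓ)))

  irregular-refutes : ∀ C → WfRec _⊏_ Adequate C → IrregularRefutes C
  irregular-refutes C below S Θ (_ , (_ ︔ _ ⟶ _) , r , i , e@(irr≈ S′≐S _ refl)) σp isP path forced =
    irregular-instance-refutes r i below σp isP (↦-respˡ-≈ e path)
      (λ A A∈S′ → forced A (≐⇒⊆ S′≐S A A∈S′))

  adequate : ∀ A → Adequate A
  adequate = WF.All.wfRec ⊏-wellFounded _ Adequate
               (λ A below → lhs-forced A below , irregular-refutes A below)

  IsP-refutes-Rhs : ∀ {τ Γ C} → IsP τ → τ ≈ (Γ ⇒ C) → ¬ τ ⊩ C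
  IsP-refutes-Rhs {_ ⇒ C} (_ , _ , (_ ⇒ _) , r , i , pr , e@(reg≈ _ refl)) (reg≈ _ refl) =
    p-refutes r i pr (λ _ → adequate _) ∘ ⊩-resp-≈ {C} (≈-sym e)
  IsP-refutes-Rhs {_ ︔ _ ⟶ _} (() , _)

  private
    ↦⇒Star : ∀ {a b} → a ↦ b → Star _↦₀_ a b
    ↦⇒Star (step s) = s ◅ ε
    ↦⇒Star (s ◅ p) = s ◅ ↦⇒Star p

    Star⇒↦* : ∀ {a b} → Star (flip _↦₀_) b a → a ↦* b
    Star⇒↦* ε = inj₁ ≈-refl
    Star⇒↦* (s ◅ back) = ↦*-snoc (Star⇒↦* back) s

  -- Walking back from σ, only RightIntro rules can lead to a regular sequent until
  -- an axiom or a join is met, and by minimality that one is φ(σ).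
  refuted-along : ∀ {σp x Γ C} → IsP σp → Star (flip _↦₀_) x σp → x ≈ (Γ ⇒ C) →
                  (∀ σ′ → IsP σ′ → σp ↦* σ′ → σ′ ↦* x → σ′ ≈ σp) → ¬ σp ⊩ C
  refuted-along isP ε σp≈σ _ = IsP-refutes-Rhs isP σp≈σ
  refuted-along isP (b↦₀x@(_ , σ′ , r , i , σ′≈x , p≈b) ◅ back) x≈σ minimal
    with ≈-trans σ′≈x x≈σ
  ... | σ′≈σ@(reg≈ _ refl) with regular-rule-view r
  ...   | inj₁ pr =
    let σp↦σ′ = ↦*-snoc (Star⇒↦* back) (_ , _ , r , i , ≈-refl , p≈b)
    in IsP-refutes-Rhs isP (≈-trans (≈-sym (minimal σ′ (instance-IsP i pr) σp↦σ′ (inj₁ σ′≈x))) σ′≈σ)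
  ...   | inj₂ (_ , intro , refl) with p≈b
  ...     | here p≈b′ =
    refutation-descends intro (λ _ → proj₁ (adequate _)) isP
      (↦*-trans (Star⇒↦* back) (inj₁ (≈-sym p≈b′)))
      (refuted-along isP back (≈-sym p≈b′)
        (λ σ″ isP″ σp↦σ″ σ″↦b → minimal σ″ isP″ σp↦σ″ (↦*-snoc σ″↦b b↦₀x)))

  φ-forces-antecedent : ∀ {Γ C σp} → IsPhi (Γ ⇒ C) σp → ∀ A → A ∈ Γ → σp ⊩ A
  φ-forces-antecedent (isP , σp↦σ , _) A A∈Γ =
    Cl-Lhs-forced isP (λ _ → proj₁ (adequate _)) (↦*-Lhs σp↦σ A A∈Γ)

  φ-refutes : ∀ {Γ C σp} → IsPhi (Γ ⇒ C) σp → ¬ σp ⊩ C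
  φ-refutes (isP , inj₁ σp≈σ , _) = IsP-refutes-Rhs isP σp≈σ
  φ-refutes (isP , inj₂ σp↦σ , minimal) = refuted-along isP (reverse id (↦⇒Star σp↦σ)) ≈-refl minimal

lemma3p9 : (G : Fm) (Γ₀ : FSet) (D : Deriv G (Γ₀ ⇒ G)) →
    let open InDerivation D in
    (∀ Γ C → Occ (Γ ⇒ C) → ∀ σp → IsPhi (Γ ⇒ C) σp →
      (∀ A → A ∈ Γ → σp ⊩ A) × ¬ (σp ⊩ C))
    × (∀ S Θ C → Occ (S ︔ Θ ⟶ C) → ∀ σp → IsP σp → (S ︔ Θ ⟶ C) ↦ σp →
      (∀ A → A ∈ S → Sf⁻ C A → σp ⊩ A) → ¬ (σp ⊩ C))
lemma3p9 G Γ₀ D =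
  (λ _ _ _ _ φ → φ-forces-antecedent φ , φ-refutes φ) , (λ S Θ C → proj₂ (adequate C) S Θ)
  where open ExtractedModel D
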